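{- The problem Dominating-Set can be defined in $\mathrm{D}\text{ -Horn}$, even without successor: there is a $\mathrm{D}\text{ -Horn}$ sentence $\varphi$ over the vocabulary $\{E,P\}$ ($E$ binary, $P$ unary; no successor relation or constants) such that for every finite undirected graph $G=(V,E)$, every $k$ with $1\le k\le|V|$ and every $P\subseteq V$ with $|P|=k$: $\langle G,k\rangle\in$ Dominating-Set if and only if $(V,E\cup\{(v,v):v\in V\},P)\models\varphi$.
   Context: Dominating-Set is the set of pairs $\langle (V,E),k\rangle$ such that there is $V'\subseteq V$ with $|V'|\le k$ such that for every $v\in V\setminus V'$ there is $u\in V'$ with $(u,v)\in E$. Dependence logic uses team semantics: for a team $X$ (set of assignments with common domain), $\mathfrak A\models_X$ a literal iff all $s\in X$ satisfy it; $\mathfrak A\models_X=\!(t_1,\dots,t_n)$ iff any $s,s'\in X$ agreeing on $t_1,\dots,t_{n-1}$ agree on $t_n$; $\mathfrak A\models_X\neg=\!(\dots)$ iff $X=\emptyset$; $\wedge$ componentwise; $\vee$: $X=Y\cup Z$ with $Y$ satisfying the left and $Z$ the right disjunct; $\mathfrak A\models_X\exists x\psi$ iff $\mathfrak A\models_{\{s(F(s)/x):s\in X\}}\psi$ for some $F:X\to A$; $\mathfrak A\models_X\forall x\psi$ iff $\mathfrak A\models_{\{s(a/x):s\in X,a\in A\}}\psi$; a sentence is true iff satisfied by $\{\emptyset\}$. A clause is a disjunction of atomic and negated atomic first-order formulae (including $\bot,\top$). A $\mathrm{D}\text{ -Horn}$ formula is a formula $\forall\overline x\exists y_1\dots\exists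 y_n(\bigwedge_{i}=\!(\overline z_i,y_i)\wedge\bigwedge_jC_j)$ where the $y_i$ are pairwise distinct, each $\overline z_i$ is a tuple of variables from $\overline x$, and each clause $C_j$ contains at most one positive (unnegated) atomic formula with an occurrence of an existentially quantified variable. -}

module Defs where

open import Data.Nat using (ℕ; zero; suc; _+_; _≤_; _<ᵇ_)
open import Data.Fin using (Fin; toℕ; _↑ˡ_; _↑ʳ_; _≟_)
open import Data.Fin.Subset using (Subset; _∈_; _∉_; ∣_∣)
open import Data.Vec using (Vec; []; _∷_; lookup)
open import Data.List using (List; []; _∷_; map; tabulate)
open import Data.List.Relation.Unary.All using (All)
open import Data.Bool using (Bool; true; false; T; _∨_; _∧_; if_then_else_)
open import Data.Product using (Σ; ∃; _×_; _,_; proj₁; proj₂)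
open import Data.Sum using (_⊎_)
open import Data.Unit using (⊤; tt)
open import Data.Empty using (⊥)
open import Relation.Nullary using (¬_)
open import Relation.Nullary.Decidable using (⌊_⌋)
open import Relation.Binary.PropositionalEquality using (_≡_)

-- Variables are well-scoped de Bruijn indices: Fin m, index 0 = innermost bound.

data Atom (m : ℕ) : Set where
  eqA  : Fin m → Fin m → Atom m
  EA   : Fin m → Fin m → Atom m
  PA   : Fin m → Atom m
  topA : Atom m
  botA : Atom m

data Formula (m : ℕ) : Set where
  pos  : Atom m → Formula m
  neg  : Atom m → Formula m
  dep  : List (Fin m) → Fin m → Formula m
  ndep : List (Fin m) → Fin m → Formula m
  _⋀_  : Formula m → Formula m → Formula m
  _⋁_  : Formula m → Formula m → Formula m
  ∃'   : Formula (suc m) → Formula m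
  ∀'   : Formula (suc m) → Formula m

record Structure : Set₁ where
  field
    size : ℕ
    Erel : Fin size → Fin size → Set
    Prel : Fin size → Set

module Semantics (𝔄 : Structure) where
  open Structure 𝔄

  A : Set
  A = Fin size

  -- assignment to the m variables in scope (position = de Bruijn index)
  Assignment : ℕ → Set
  Assignment m = Vec A m

  holds : ∀ {m} → Atom m → Assignment m → Set
  holds (eqA i j) s = lookup s i ≡ lookup s j
  holds (EA i j)  s = Erel (lookup s i) (lookup s j)
  holds (PA i)    s = Prel (lookup s i)
  holds topA      s = ⊤
  holds botA      s = ⊥

  Team : ℕ → Set
  Team m = Assignment m → Bool

  -- {s(F(s)/x) : s ∈ X} where F : X → A
  extendVal : (b : Bool) → (T b → A) → A → Bool
  extendVal true  f a = ⌊ a ≟ f tt ⌋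
  extendVal false f a = false

  supplement : ∀ {m} (X : Team m) → ((s : Assignment m) → T (X s) → A) → Team (suc m)
  supplement X F (a ∷ s) = extendVal (X s) (F s) a

  duplicate : ∀ {m} → Team m → Team (suc m)
  duplicate X (a ∷ s) = X s

  sat : ∀ {m} → Formula m → Team m → Set
  sat (pos a)     X = ∀ s → T (X s) → holds a s
  sat (neg a)     X = ∀ s → T (X s) → ¬ holds a s
  sat (dep zs y)  X = ∀ s s' → T (X s) → T (X s') →
                        map (lookup s) zs ≡ map (lookup s') zs →
                        lookup s y ≡ lookup s' y
  sat (ndep zs y) X = ∀ s → ¬ T (X s)
  sat (φ ⋀ ψ)     X = sat φ X × sat ψ X
  sat (φ ⋁ ψ)     X = Σ (Team _) λ Y → Σ (Team _) λ Z →
                        (∀ s → X s ≡ (Y s ∨ Z s)) × sat φ Y × sat ψ Z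
  sat (∃' φ)      X = Σ ((s : Assignment _) → T (X s) → A) λ F →
                        sat φ (supplement X F)
  sat (∀' φ)      X = sat φ (duplicate X)

-- truth of a sentence: satisfaction by the team {∅}
_⊨_ : Structure → Formula 0 → Set
𝔄 ⊨ φ = Semantics.sat 𝔄 φ (λ _ → true)

Literal : ℕ → Set
Literal m = Bool × Atom m      -- true = positive, false = negated

literal : ∀ {m} → Literal m → Formula m
literal (true  , a) = pos a
literal (false , a) = neg a

clause : ∀ {m} → List (Literal m) → Formula m
clause []           = pos botA
clause (l ∷ [])     = literal l
clause (l ∷ k ∷ ls) = literal l ⋁ clause (k ∷ ls)

bigAnd : ∀ {m} → List (Formula m) → Formula m
bigAnd []           = pos topA
bigAnd (φ ∷ [])     = φ
bigAnd (φ ∷ ψ ∷ φs) = φ ⋀ bigAnd (ψ ∷ φs)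

foralls : ∀ {m} a → Formula (a + m) → Formula m
foralls zero    φ = φ
foralls (suc a) φ = foralls a (∀' φ)

exists : ∀ {m} b → Formula (b + m) → Formula m
exists zero    φ = φ
exists (suc b) φ = exists b (∃' φ)

atomMentions : ∀ {m} → (Fin m → Bool) → Atom m → Bool
atomMentions p (eqA i j) = p i ∨ p j
atomMentions p (EA i j)  = p i ∨ p j
atomMentions p (PA i)    = p i
atomMentions p topA      = false
atomMentions p botA      = false

countPosEx : ∀ {m} → (Fin m → Bool) → List (Literal m) → ℕ
countPosEx p []            = 0
countPosEx p ((s , a) ∷ ls) =
  (if s ∧ atomMentions p a then 1 else 0) + countPosEx p ls

-- Matrix context: a universal variables x1..xa, then b existential y1..yb.
-- In de Bruijn order the existentials are indices 0..b-1, the universals b..b+a-1.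
Ctx : ℕ → ℕ → Set
Ctx a b = Fin (b + (a + 0))

exVar : ∀ {a b} → Fin b → Ctx a b
exVar {a} i = i ↑ˡ (a + 0)

univVar : ∀ {a b} → Fin a → Ctx a b
univVar {a} {b} j = b ↑ʳ (j ↑ˡ 0)

isExVar : ∀ {a b} → Ctx a b → Bool
isExVar {a} {b} v = toℕ v <ᵇ b

record DHorn : Set where
  field
    nUniv   : ℕ
    nEx     : ℕ
    -- for each existential y_i, the tuple z̄_i of universal variables in =(z̄_i, y_i)
    depArgs : Vec (List (Fin nUniv)) nEx
    clauses : List (List (Literal (nEx + (nUniv + 0))))
    horn    : All (λ C → countPosEx (isExVar {nUniv} {nEx}) C ≤ 1) clauses

  sentence : Formula 0
  sentence =
    foralls nUniv (exists nEx
      (bigAnd (tabulate (λ i → dep (map (univVar {nUniv} {nEx}) (lookup depArgs i))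
                                   (exVar {nUniv} {nEx} i)))
       ⋀ bigAnd (map clause clauses)))

Graph : ℕ → Set
Graph n = Fin n → Fin n → Bool

Undirected : ∀ {n} → Graph n → Set
Undirected G = ∀ u v → G u v ≡ G v u

DominatingSet : ∀ n → Graph n → ℕ → Set
DominatingSet n G k =
  Σ (Subset n) λ V' → (∣ V' ∣ ≤ k) ×
    (∀ v → v ∉ V' → Σ (Fin n) λ u → (u ∈ V') × T (G u v))

reflStructure : ∀ n → Graph n → Subset n → Structure
reflStructure n G P = record
  { size = n
  ; Erel = λ u v → T (G u v) ⊎ u ≡ v
  ; Prel = λ v → v ∈ P
  }

module Submission where

--   φ  =  ∀x ∀z ∃c ∃d ( =(z,d) ∧ =(x,c) ∧ P c ∧ (z ≠ c ∨ E d x) ).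
--
-- Reading c as a "label" of x taken from P, and d as the vertex "decoded"
-- from the label z, φ says: there are functions label and decode such that
-- every label lies in P and decode (label v) is E-adjacent to v.

open import Data.Bool using (Bool; true; false; T; _∨_; _∧_; not)
open import Data.Bool.Properties using (T-∧; T-∨)
open import Data.Empty using (⊥-elim)
open import Data.Fin using (Fin; zero; suc; _≟_)
open import Data.Fin.Subset using (Subset; _∈_; _∉_; _⊆_; ∣_∣; ⊥)
open import Data.Fin.Subset.Properties using (_∈?_; ∣⊥∣≡0)
open import Data.List using ([]; _∷_)
open import Data.List.Relation.Unary.All using ([]; _∷_)
open import Data.Maybe using (Maybe; just; nothing; fromMaybe)
import Data.Maybe as Maybe
open import Data.Nat using (ℕ; suc; _≤_; z≤n; s≤s)
open import Data.Nat.Properties using (≤-refl; ≤-trans; ≤-reflexive; m≤n⇒m≤1+n)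
open import Data.Product using (Σ; _×_; _,_; proj₁; proj₂)
open import Data.Sum using (_⊎_; inj₁; inj₂)
open import Data.Unit using (tt)
open import Data.Vec using ([]; _∷_; lookup; here; there)
open import Function using (_∘_)
open import Function.Bundles using (Equivalence)
open import Relation.Binary.PropositionalEquality
  using (_≡_; _≢_; refl; sym; trans; cong; subst)
open import Relation.Nullary using (yes; no)
open import Relation.Nullary.Decidable using (⌊_⌋; toWitness; toWitnessFalse; fromWitness)
open import Defs

x̂ ẑ ĉ d̂ : Ctx 2 2
x̂ = univVar {2} {2} (suc zero)
ẑ = univVar {2} {2} zero
ĉ = exVar {2} {2} (suc zero)
d̂ = exVar {2} {2} zero

dominationSentence : DHorn
dominationSentence = record
  { nUniv   = 2
  ; nEx     = 2
  ; depArgs = (zero ∷ []) ∷ (suc zero ∷ []) ∷ []    -- =(z, d) and =(x, c)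
  ; clauses = ((true , PA ĉ) ∷ [])                   -- P c
            ∷ ((false , eqA ẑ ĉ) ∷ (true , EA d̂ x̂) ∷ [])  -- z ≠ c ∨ E d x
            ∷ []
  ; horn    = s≤s z≤n ∷ s≤s z≤n ∷ []
  }

DominationCode : Structure → Set
DominationCode 𝔄 = Σ (A → A) λ label → Σ (A → A) λ decode →
    (∀ v → Prel (label v)) × (∀ v → Erel (decode (label v)) v)
  where open Structure 𝔄
        open Semantics 𝔄

-- A Boolean test b splits x into x ∧ ¬ b and x ∧ b; applied pointwise it
-- splits a team into the parts satisfying the two disjuncts.
split-∧-not : ∀ x b → x ≡ ((x ∧ not b) ∨ (x ∧ b))
split-∧-not true  true  = refl
split-∧-not true  false = refl
split-∧-not false _     = refl

module DominationSemantics (𝔄 : Structure) where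
  open Structure 𝔄
  open Semantics 𝔄

  extendVal-elim : ∀ b (f : T b → A) a → T (extendVal b f a) → Σ (T b) λ t → a ≡ f t
  extendVal-elim true f a a≡f = tt , toWitness a≡f

  extendVal-intro : ∀ b (f : T b → A) (t : T b) → T (extendVal b f (f t))
  extendVal-intro true f tt = fromWitness refl

  -- The team {∅} after the prefix ∀x ∀z: all pairs (z, x).
  allPairs : Team 2
  allPairs = duplicate (duplicate (λ _ → true))

  prefixTeam : (F₁ : (s : Assignment 2) → T (allPairs s) → A)
             → ((s : Assignment 3) → T (supplement allPairs F₁ s) → A)
             → Team 4
  prefixTeam F₁ F₂ = supplement (supplement allPairs F₁) F₂

  -- A code yields Skolem functions c := label x, d := decode z, and the
  -- resulting team consists exactly of the tuples (decode z, label x, z, x).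
  module FromCode (label decode : A → A) where
    skolem-c : (s : Assignment 2) → T (allPairs s) → A
    skolem-c (z ∷ x ∷ []) _ = label x

    skolem-d : (s : Assignment 3) → T (supplement allPairs skolem-c s) → A
    skolem-d (c ∷ z ∷ x ∷ []) _ = decode z

    team : Team 4
    team = prefixTeam skolem-c skolem-d

    member : ∀ d c z x → T (team (d ∷ c ∷ z ∷ x ∷ [])) → (c ≡ label x) × (d ≡ decode z)
    member d c z x d∈ with extendVal-elim _ _ d d∈
    ... | c∈ , d≡ = proj₂ (extendVal-elim true _ c c∈) , d≡

    -- The test z = c splits the team for the disjunction  z ≠ c ∨ E d x.
    z≡c? : Assignment 4 → Bool
    z≡c? s = ⌊ lookup s ẑ ≟ lookup s ĉ ⌋

    different : Team 4
    different s = team s ∧ not (z≡c? s)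

    equal : Team 4
    equal s = team s ∧ z≡c? s

    different-sat : sat (neg (eqA ẑ ĉ)) different
    different-sat s s∈ =
      toWitnessFalse (proj₂ (Equivalence.to (T-∧ {team s}) s∈))

    equal-sat : (∀ v → Erel (decode (label v)) v) → sat (pos (EA d̂ x̂)) equal
    equal-sat dominates s@(d ∷ c ∷ z ∷ x ∷ []) s∈ =
      subst (λ u → Erel u x) (sym d≡decode-label-x) (dominates x)
      where
      s∈team : T (team s)
      s∈team = proj₁ (Equivalence.to (T-∧ {team s}) s∈)
      z≡c : z ≡ c
      z≡c = toWitness (proj₂ (Equivalence.to (T-∧ {team s}) s∈))
      d≡decode-label-x : d ≡ decode (label x)
      d≡decode-label-x with member d c z x s∈team
      ... | c≡label-x , d≡decode-z = trans d≡decode-z (cong decode (trans z≡c c≡label-x))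

  code⇒sentence : DominationCode 𝔄 → 𝔄 ⊨ DHorn.sentence dominationSentence
  code⇒sentence (label , decode , inP , dominates) =
    skolem-c , skolem-d , (d-depends-on-z , c-depends-on-x) , c-in-P ,
    (different , equal , (λ s → split-∧-not (team s) (z≡c? s)) ,
     different-sat , equal-sat dominates)
    where
    open FromCode label decode

    d-depends-on-z : sat (dep (ẑ ∷ []) d̂) team
    d-depends-on-z (d ∷ c ∷ z ∷ x ∷ []) (d' ∷ c' ∷ .z ∷ x' ∷ []) s∈ s'∈ refl =
      trans (proj₂ (member d c z x s∈)) (sym (proj₂ (member d' c' z x' s'∈)))

    c-depends-on-x : sat (dep (x̂ ∷ []) ĉ) team
    c-depends-on-x (d ∷ c ∷ z ∷ x ∷ []) (d' ∷ c' ∷ z' ∷ .x ∷ []) s∈ s'∈ refl =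
      trans (proj₁ (member d c z x s∈)) (sym (proj₁ (member d' c' z' x s'∈)))

    c-in-P : sat (pos (PA ĉ)) team
    c-in-P (d ∷ c ∷ z ∷ x ∷ []) s∈ = subst Prel (sym (proj₁ (member d c z x s∈))) (inP x)

  -- Conversely, the Skolem functions of a satisfying team give a code:
  -- label v := c(v, v) and decode z := d(z, z); the dependence atoms say
  -- that c(z, x) does not depend on z and d(z, x) does not depend on x.
  sentence⇒code : 𝔄 ⊨ DHorn.sentence dominationSentence → DominationCode 𝔄
  sentence⇒code (F₁ , F₂ , (d-dep-z , c-dep-x) , c-in-P , (Y , Z , X≡Y∪Z , Y-sat , Z-sat)) =
    label , decode , label-in-P , dominates
    where
    c : A → A → A
    c z x = F₁ (z ∷ x ∷ []) tt

    c∈ : ∀ z x → T (supplement allPairs F₁ (c z x ∷ z ∷ x ∷ []))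
    c∈ z x = extendVal-intro true (F₁ (z ∷ x ∷ [])) tt

    d : A → A → A
    d z x = F₂ (c z x ∷ z ∷ x ∷ []) (c∈ z x)

    chosen : A → A → Assignment 4
    chosen z x = d z x ∷ c z x ∷ z ∷ x ∷ []

    chosen∈ : ∀ z x → T (prefixTeam F₁ F₂ (chosen z x))
    chosen∈ z x = extendVal-intro _ (F₂ (c z x ∷ z ∷ x ∷ [])) (c∈ z x)

    label decode : A → A
    label v = c v v
    decode z = d z z

    label-in-P : ∀ v → Prel (label v)
    label-in-P v = c-in-P (chosen v v) (chosen∈ v v)

    c-indep : ∀ z z' x → c z x ≡ c z' x
    c-indep z z' x = c-dep-x (chosen z x) (chosen z' x) (chosen∈ z x) (chosen∈ z' x) refl

    d-indep : ∀ z x x' → d z x ≡ d z x'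
    d-indep z x x' = d-dep-z (chosen z x) (chosen z x') (chosen∈ z x) (chosen∈ z x') refl

    dominates : ∀ v → Erel (decode (label v)) v
    -- The assignment for z = label v, x = v lies in Y or in Z.  In Y it
    -- would refute z = c, since c = c(label v, v) = label v; in Z it gives
    -- E d x with d = d(label v, v) = decode (label v).
    dominates v
      with Equivalence.to T-∨ (subst T (X≡Y∪Z (chosen (label v) v)) (chosen∈ (label v) v))
    ... | inj₁ s∈Y = ⊥-elim (Y-sat _ s∈Y (sym (c-indep (label v) v v)))
    ... | inj₂ s∈Z = subst (λ u → Erel u v) (d-indep (label v) v (label v)) (Z-sat _ s∈Z)

insert : ∀ {n} → Fin n → Subset n → Subset n
insert zero    (_ ∷ p) = true ∷ p
insert (suc i) (b ∷ p) = b ∷ insert i p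

∣insert∣≤ : ∀ {n} (i : Fin n) (p : Subset n) → ∣ insert i p ∣ ≤ suc ∣ p ∣
∣insert∣≤ zero    (true  ∷ p) = m≤n⇒m≤1+n ≤-refl
∣insert∣≤ zero    (false ∷ p) = ≤-refl
∣insert∣≤ (suc i) (true  ∷ p) = s≤s (∣insert∣≤ i p)
∣insert∣≤ (suc i) (false ∷ p) = ∣insert∣≤ i p

∈insert : ∀ {n} (i : Fin n) (p : Subset n) → i ∈ insert i p
∈insert zero    (_ ∷ p) = here
∈insert (suc i) (_ ∷ p) = there (∈insert i p)

⊆insert : ∀ {n} (i : Fin n) (p : Subset n) → p ⊆ insert i p
⊆insert zero    (_ ∷ p) here      = here
⊆insert zero    (_ ∷ p) (there x) = there x
⊆insert (suc i) (_ ∷ p) here      = here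
⊆insert (suc i) (_ ∷ p) (there x) = there (⊆insert i p x)

image : ∀ {m n} → (Fin m → Fin n) → Subset m → Subset n
image g []          = ⊥
image g (false ∷ p) = image (g ∘ suc) p
image g (true  ∷ p) = insert (g zero) (image (g ∘ suc) p)

∣image∣≤ : ∀ {m n} (g : Fin m → Fin n) (p : Subset m) → ∣ image g p ∣ ≤ ∣ p ∣
∣image∣≤ {n = n} g [] = ≤-reflexive (∣⊥∣≡0 n)
∣image∣≤ g (false ∷ p) = ∣image∣≤ (g ∘ suc) p
∣image∣≤ g (true  ∷ p) = ≤-trans (∣insert∣≤ (g zero) _) (s≤s (∣image∣≤ (g ∘ suc) p))

∈image : ∀ {m n} (g : Fin m → Fin n) (p : Subset m) {i} → i ∈ p → g i ∈ image g p
∈image g (true  ∷ p) here      = ∈insert (g zero) _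
∈image g (false ∷ p) (there i) = ∈image (g ∘ suc) p i
∈image g (true  ∷ p) (there i) = ⊆insert (g zero) _ (∈image (g ∘ suc) p i)

removeOne : ∀ {m} (P : Subset m) k → suc k ≤ ∣ P ∣ →
  Σ (Fin m) λ p → Σ (Subset m) λ P' → p ∈ P × p ∉ P' × P' ⊆ P × k ≤ ∣ P' ∣
removeOne (true  ∷ P) k (s≤s k≤∣P∣) =
  zero , false ∷ P , here , (λ ()) , (λ { (there i) → there i }) , k≤∣P∣
removeOne (false ∷ P) k k<∣P∣ with removeOne P k k<∣P∣
... | p , P' , p∈P , p∉P' , P'⊆P , k≤∣P'∣ =
  suc p , false ∷ P' , there p∈P , (λ { (there p∈) → p∉P' p∈ }) ,
  (λ { (there i) → there (P'⊆P i) }) , k≤∣P'∣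

Covers : ∀ {m n} → (Fin m → Maybe (Fin n)) → Subset m → Subset n → Set
Covers {m} decode P D = ∀ {d} → d ∈ D → Σ (Fin m) λ p → p ∈ P × decode p ≡ just d

decodeNew : ∀ {m n} → Fin m → (Fin m → Maybe (Fin n)) → Fin m → Maybe (Fin (suc n))
decodeNew p₀ decode p with p ≟ p₀
... | yes _ = just zero
... | no  _ = Maybe.map suc (decode p)

decodeNew-new : ∀ {m n} p₀ (decode : Fin m → Maybe (Fin n)) → decodeNew p₀ decode p₀ ≡ just zero
decodeNew-new p₀ decode with p₀ ≟ p₀
... | yes _     = refl
... | no  p₀≢p₀ = ⊥-elim (p₀≢p₀ refl)

decodeNew-old : ∀ {m n} {p₀ p} (decode : Fin m → Maybe (Fin n)) → p ≢ p₀ →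
                decodeNew p₀ decode p ≡ Maybe.map suc (decode p)
decodeNew-old {p₀ = p₀} {p} decode p≢p₀ with p ≟ p₀
... | yes p≡p₀ = ⊥-elim (p≢p₀ p≡p₀)
... | no  _    = refl

labelling : ∀ {m n} (D : Subset n) (P : Subset m) → ∣ D ∣ ≤ ∣ P ∣ →
  Σ (Fin m → Maybe (Fin n)) λ decode → Covers decode P D
labelling [] P _ = (λ _ → nothing) , λ ()
labelling (false ∷ D) P ∣D∣≤∣P∣ with labelling D P ∣D∣≤∣P∣
... | decode , covers = Maybe.map suc ∘ decode , λ where
  (there d∈D) → let (p , p∈P , decode-p) = covers d∈D in p , p∈P , cong (Maybe.map suc) decode-p
labelling (true ∷ D) P ∣D∣<∣P∣ with removeOne P ∣ D ∣ ∣D∣<∣P∣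
... | p₀ , P' , p₀∈P , p₀∉P' , P'⊆P , ∣D∣≤∣P'∣ with labelling D P' ∣D∣≤∣P'∣
... | decode , covers = decodeNew p₀ decode , λ where
  here        → p₀ , p₀∈P , decodeNew-new p₀ decode
  (there d∈D) → let (p , p∈P' , decode-p) = covers d∈D
                    p≢p₀ : p ≢ p₀
                    p≢p₀ p≡p₀ = p₀∉P' (subst (_∈ P') p≡p₀ p∈P')
                in p , P'⊆P p∈P' ,
                   trans (decodeNew-old decode p≢p₀) (cong (Maybe.map suc) decode-p)

closedDominator : ∀ {n} (G : Graph n) {D : Subset n} →
  (∀ v → v ∉ D → Σ (Fin n) λ u → u ∈ D × T (G u v)) →
  ∀ v → Σ (Fin n) λ u → u ∈ D × (T (G u v) ⊎ u ≡ v)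
closedDominator G {D} dominated v with v ∈? D
... | yes v∈D = v , v∈D , inj₂ refl
... | no  v∉D with dominated v v∉D
...   | u , u∈D , Guv = u , u∈D , inj₁ Guv

module _ {n : ℕ} (G : Graph n) (P : Subset n) where

  -- A dominating set of size ≤ ∣ P ∣ gives a code: label v names the
  -- dominator of v, and labels outside the range decode to themselves.
  dominatingSet⇒code : DominatingSet n G ∣ P ∣ → DominationCode (reflStructure n G P)
  dominatingSet⇒code (D , ∣D∣≤∣P∣ , dominated) =
    label , decode , (λ v → proj₁ (proj₂ (labelOf v))) , dominates
    where
    open Σ (labelling D P ∣D∣≤∣P∣) renaming (proj₁ to partialDecode; proj₂ to covers)

    dominator : ∀ v → Σ (Fin n) λ u → u ∈ D × (T (G u v) ⊎ u ≡ v)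
    dominator = closedDominator G dominated

    labelOf : ∀ v → Σ (Fin n) λ p → p ∈ P × partialDecode p ≡ just (proj₁ (dominator v))
    labelOf v = covers (proj₁ (proj₂ (dominator v)))

    label decode : Fin n → Fin n
    label v = proj₁ (labelOf v)
    decode p = fromMaybe p (partialDecode p)

    dominates : ∀ v → T (G (decode (label v)) v) ⊎ decode (label v) ≡ v
    dominates v rewrite proj₂ (proj₂ (labelOf v)) = proj₂ (proj₂ (dominator v))

  code⇒dominatingSet : DominationCode (reflStructure n G P) → DominatingSet n G ∣ P ∣
  code⇒dominatingSet (label , decode , inP , dominates) =
    image decode P , ∣image∣≤ decode P , dominated
    where
    dominator∈ : ∀ v → decode (label v) ∈ image decode P
    dominator∈ v = ∈image decode P (inP v)

    dominated : ∀ v → v ∉ image decode P → Σ (Fin n) λ u → u ∈ image decode P × T (G u v)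
    dominated v v∉D with dominates v
    ... | inj₁ Guv = decode (label v) , dominator∈ v , Guv
    ... | inj₂ u≡v = ⊥-elim (v∉D (subst (_∈ image decode P) u≡v (dominator∈ v)))

-- The theorem: φ defines Dominating-Set once ∣ P ∣ = k.

open DominationSemantics using (code⇒sentence; sentence⇒code)

theorem4p5 : Σ DHorn λ φ →
    ∀ (n : ℕ) (G : Graph n) → Undirected G →
    ∀ (k : ℕ) → 1 ≤ k → k ≤ n →
    ∀ (P : Subset n) → ∣ P ∣ ≡ k →
      (DominatingSet n G k → reflStructure n G P ⊨ DHorn.sentence φ)
      × (reflStructure n G P ⊨ DHorn.sentence φ → DominatingSet n G k)
theorem4p5 = dominationSentence , λ where
  n G _ k _ _ P refl →
    (code⇒sentence (reflStructure n G P) ∘ dominatingSet⇒code G P) ,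
    (code⇒dominatingSet G P ∘ sentence⇒code (reflStructure n G P))
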